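{- Let $p$ be an odd prime and $G$ a finite $p$-group. Then $\Gamma(G)$ is a cograph if and only if $G$ has exponent $p$.
   Context: For a finite group $G$, the prime-order element graph $\Gamma(G)$ is the simple graph with vertex set $G$ in which two distinct vertices $x,y$ are adjacent if and only if the order of $xy$ is a prime. A cograph is a graph with no induced path on four vertices. -}

module Defs where

open import Level using (0ℓ)
open import Algebra.Bundles using (Group)
open import Data.Nat using (ℕ; zero; suc; _<_; _≤_; _^_)
open import Data.Nat.Primality using (Prime)
open import Data.Fin using (Fin)
open import Data.Product using (Σ; ∃; _×_; _,_)
open import Relation.Nullary using (¬_)
open import Relation.Binary.PropositionalEquality using (_≡_)

record FiniteGroup : Set₁ where
  field
    group     : Group 0ℓ 0ℓ
  open Group group public
  field
    size      : ℕ
    enum      : Fin size → Carrier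
    enum-surj : ∀ x → ∃ λ i → enum i ≈ x
    enum-inj  : ∀ i j → enum i ≈ enum j → i ≡ j

module _ (G : FiniteGroup) where
  open FiniteGroup G

  pow : Carrier → ℕ → Carrier
  pow g zero    = ε
  pow g (suc n) = g ∙ pow g n

  IsOrder : Carrier → ℕ → Set
  IsOrder g n = 0 < n × pow g n ≈ ε × (∀ m → 0 < m → m < n → ¬ (pow g m ≈ ε))

  HasPrimeOrder : Carrier → Set
  HasPrimeOrder g = Σ ℕ λ n → IsOrder g n × Prime n

  IsExponent : ℕ → Set
  IsExponent n = 0 < n × (∀ g → pow g n ≈ ε)
               × (∀ m → 0 < m → m < n → ¬ (∀ g → pow g m ≈ ε))

  IsNontrivialPGroup : ℕ → Set
  IsNontrivialPGroup p = Σ ℕ λ k → 1 ≤ k × size ≡ p ^ k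

  ΓAdj : Carrier → Carrier → Set
  ΓAdj x y = ¬ (x ≈ y) × HasPrimeOrder (x ∙ y)

  InducedP4 : Carrier → Carrier → Carrier → Carrier → Set
  InducedP4 a b c d =
    ¬ (a ≈ b) × ¬ (a ≈ c) × ¬ (a ≈ d) × ¬ (b ≈ c) × ¬ (b ≈ d) × ¬ (c ≈ d)
    × ΓAdj a b × ΓAdj b c × ΓAdj c d
    × ¬ ΓAdj a c × ¬ ΓAdj a d × ¬ ΓAdj b d

  ΓIsCograph : Set
  ΓIsCograph = ¬ (Σ Carrier λ a → Σ Carrier λ b → Σ Carrier λ c → Σ Carrier λ d →
                  InducedP4 a b c d)

-- If G has exponent p, every element other than ε has order p, so two distinct elements are
-- adjacent in Γ(G) unless they are mutually inverse; in an induced path a - b - c - d both c and d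
-- would then be the inverse of a.  Conversely, left translation by g permutes G in cycles of
-- length ord g, so element orders of a p-group divide |G| = pᵏ; if the exponent is not p, some
-- element x has order p².  Then x^i and x^j are adjacent exactly when p ∣ i + j but p² ∤ i + j,
-- and for odd p the powers x, x^(p-1), x^(p+1), x^(p²-1) form an induced P4.

module Submission where

open import Data.Fin using (Fin; toℕ; fromℕ<)
import Data.Fin.Properties as FinP
open import Data.List using (List; []; _∷_; length; filter)
open import Data.List.Membership.Propositional using (_∈_)
open import Data.List.Membership.Propositional.Properties using (∈-filter⁻; ∈-filter⁺; ∈-allFin)
open import Data.List.Properties using (filter-all; length-tabulate)
open import Data.List.Relation.Unary.All as All using (All)
open import Data.List.Relation.Unary.AllPairs using (_∷_)
open import Data.List.Relation.Unary.Any using (here; there)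
open import Data.List.Relation.Unary.Unique.Propositional using (Unique)
import Data.List.Relation.Unary.Unique.Propositional.Properties as Unique
import Data.Nat as ℕ
open import Data.Nat
  using (ℕ; zero; suc; pred; _+_; _*_; _∸_; _≤_; _<_; z≤n; s≤s; z<s;
         NonZero; >-nonZero; >-nonZero⁻¹; nonTrivial⇒n>1)
open import Data.Nat.Coprimality using (Coprime; coprime-divisor)
open import Data.Nat.Divisibility
  using (_∣_; _∣?_; divides; ∣-refl; ∣-reflexive; ∣-trans; m∣m*n; n∣m*n; ∣m∣n⇒∣m+n; ∣m+n∣m⇒∣n;
         *-monoʳ-∣; *-cancelˡ-∣; *-cancelʳ-∣; >⇒∤; m%n≡0⇒n∣m)
open import Data.Nat.DivMod using (_%_; _/_; m≡m%n+[m/n]*n; m%n<n)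
open import Data.Nat.Induction using (<-wellFounded)
open import Data.Nat.Primality
  using (Prime; prime⇒irreducible; prime⇒nonZero; prime⇒nonTrivial; euclidsLemma; ¬prime[0]; ¬prime[1])
open import Data.Nat.Properties
open import Data.Nat.Tactic.RingSolver using (solve-∀)
open import Data.Product using (∃; _×_; _,_; proj₁; proj₂)
open import Data.Sum using (_⊎_; inj₁; inj₂; [_,_]′)
open import Function using (id; _∘_; _on_; _⇔_; mk⇔; Equivalence)
open import Induction.WellFounded using (Acc; acc)
import Relation.Binary.Construct.On as On
open import Relation.Binary.Definitions using (DecidableEquality)
open import Relation.Binary.PropositionalEquality
  using (_≡_; _≢_; ≢-sym; refl; sym; trans; cong; cong₂; cong-app; subst; module ≡-Reasoning)
open import Relation.Nullary using (Dec; ¬_; yes; no; ¬?; contradiction)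
open import Relation.Unary using (Decidable)

open import Defs

module _ {P : ℕ → Set} (P? : Decidable P) where

  LeastPositive : ℕ → Set
  LeastPositive m = 0 < m × P m × (∀ k → 0 < k → k < m → ¬ P k)

  private
    search : ∀ b → ∃ LeastPositive ⊎ (∀ k → 0 < k → k ≤ b → ¬ P k)
    search zero = inj₂ λ { _ () z≤n }
    search (suc b) with search b
    ... | inj₁ found = inj₁ found
    ... | inj₂ none with P? (suc b)
    ...   | yes P[1+b] = inj₁ (suc b , z<s , P[1+b] , λ k 0<k k<1+b → none k 0<k (≤-pred k<1+b))
    ...   | no ¬P[1+b] = inj₂ λ k 0<k k≤1+b →
      [ none k 0<k ∘ ≤-pred , (λ { refl → ¬P[1+b] }) ]′ (m≤n⇒m<n∨m≡n k≤1+b)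

  leastPositive : ∀ {n} → 0 < n → P n → ∃ LeastPositive
  leastPositive {n} 0<n Pn with search n
  ... | inj₁ found = found
  ... | inj₂ none  = contradiction Pn (none n 0<n ≤-refl)

∣p*p⇒∣p⊎≡p*p : ∀ {p d} → Prime p → d ∣ p * p → d ∣ p ⊎ d ≡ p * p
∣p*p⇒∣p⊎≡p*p {p} {d} p-prime d∣p*p with p ∣? d
... | yes (divides q refl) with prime⇒irreducible p-prime (*-cancelʳ-∣ {q} {p} p {{prime⇒nonZero p-prime}} d∣p*p)
...   | inj₁ refl = inj₁ (∣-reflexive (*-identityˡ p))
...   | inj₂ refl = inj₂ refl
∣p*p⇒∣p⊎≡p*p {p} {d} p-prime d∣p*p | no p∤d = inj₁ (coprime-divisor d⊥p d∣p*p)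
  where
  d⊥p : Coprime d p
  d⊥p (i∣d , i∣p) with prime⇒irreducible p-prime i∣p
  ... | inj₁ i≡1 = i≡1
  ... | inj₂ refl = contradiction i∣d p∤d

module _ {A : Set} (_≟_ : DecidableEquality A) where

  open import Function.Endo.Propositional A using (_^_; ^-homo)

  delete : A → List A → List A
  delete x = filter (λ y → ¬? (y ≟ x))

  length-delete : ∀ {x xs} → Unique xs → x ∈ xs → length xs ≡ suc (length (delete x xs))
  length-delete {x} {y ∷ ys} (y∉ys ∷ _) _ with y ≟ x
  ... | yes refl = cong (suc ∘ length) (sym (filter-all _ (All.map ≢-sym y∉ys)))
  length-delete {x} {y ∷ ys} _ (here x≡y)   | no y≢x = contradiction (sym x≡y) y≢x
  length-delete {x} {y ∷ ys} (_ ∷ u) (there x∈ys) | no _ = cong suc (length-delete u x∈ys)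

  module CycleCounting (σ : A → A) (n : ℕ) .{{_ : NonZero n}}
                       (σ^n≗id : ∀ x → (σ ^ n) x ≡ x)
                       (σ^k-fixes-nothing : ∀ {k} x → 0 < k → k < n → (σ ^ k) x ≢ x) where

    σ^k∘σ≗σ^[1+k] : ∀ k x → (σ ^ k) (σ x) ≡ (σ ^ suc k) x
    σ^k∘σ≗σ^[1+k] zero    x = refl
    σ^k∘σ≗σ^[1+k] (suc k) x = cong σ (σ^k∘σ≗σ^[1+k] k x)

    σ^pred-n∘σ≗id : ∀ x → (σ ^ pred n) (σ x) ≡ x
    σ^pred-n∘σ≗id x = begin
      (σ ^ pred n) (σ x)    ≡⟨ σ^k∘σ≗σ^[1+k] (pred n) x ⟩
      (σ ^ suc (pred n)) x  ≡⟨ cong (λ k → (σ ^ k) x) (suc-pred n) ⟩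
      (σ ^ n) x             ≡⟨ σ^n≗id x ⟩
      x                     ∎
      where open ≡-Reasoning

    σ-injective : ∀ {x y} → σ x ≡ σ y → x ≡ y
    σ-injective {x} {y} σx≡σy =
      trans (sym (σ^pred-n∘σ≗id x)) (trans (cong (σ ^ pred n) σx≡σy) (σ^pred-n∘σ≗id y))

    cycle-distinct : ∀ h {j k} → j < k → k < n → (σ ^ j) h ≢ (σ ^ k) h
    cycle-distinct h {j} {k} j<k k<n σʲh≡σᵏh =
      σ^k-fixes-nothing ((σ ^ j) h) (m<n⇒0<n∸m j<k) (≤-<-trans (m∸n≤m k j) k<n) (begin
        (σ ^ (k ∸ j)) ((σ ^ j) h) ≡⟨ cong-app (^-homo σ (k ∸ j) j) h ⟨
        (σ ^ (k ∸ j + j)) h       ≡⟨ cong (λ i → (σ ^ i) h) (m∸n+n≡m (<⇒≤ j<k)) ⟩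
        (σ ^ k) h                 ≡⟨ σʲh≡σᵏh ⟨
        (σ ^ j) h                 ∎)
      where open ≡-Reasoning

    σ⁻¹-on-cycle : ∀ {h y k} → k < n → σ y ≡ (σ ^ k) h → ∃ λ j → j < n × y ≡ (σ ^ j) h
    σ⁻¹-on-cycle {h} {y} {zero} _ σy≡h =
      pred n , ≤-reflexive (suc-pred n) , trans (sym (σ^pred-n∘σ≗id y)) (cong (σ ^ pred n) σy≡h)
    σ⁻¹-on-cycle {k = suc k} k<n σy≡σᵏ⁺¹h = k , <-trans (n<1+n k) k<n , σ-injective σy≡σᵏ⁺¹h

    Closed : List A → Set
    Closed xs = ∀ {x} → x ∈ xs → σ x ∈ xs

    Closed⇒σ^k∈ : ∀ {xs h} → Closed xs → h ∈ xs → ∀ k → (σ ^ k) h ∈ xs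
    Closed⇒σ^k∈ c h∈xs zero    = h∈xs
    Closed⇒σ^k∈ c h∈xs (suc k) = c (Closed⇒σ^k∈ c h∈xs k)

    strip : ℕ → A → List A → List A
    strip zero    h xs = xs
    strip (suc m) h xs = delete ((σ ^ m) h) (strip m h xs)

    ∈-strip⁻ : ∀ m {h x xs} → x ∈ strip m h xs → x ∈ xs × (∀ {k} → k < m → x ≢ (σ ^ k) h)
    ∈-strip⁻ zero    x∈ = x∈ , λ ()
    ∈-strip⁻ (suc m) x∈ with ∈-filter⁻ (λ y → ¬? (y ≟ _)) x∈
    ... | x∈strip , x≢σᵐh with ∈-strip⁻ m x∈strip
    ...   | x∈xs , avoids = x∈xs , λ k<1+m →
      [ avoids , (λ { refl → x≢σᵐh }) ]′ (m≤n⇒m<n∨m≡n (≤-pred k<1+m))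

    ∈-strip⁺ : ∀ m {h x xs} → x ∈ xs → (∀ {k} → k < m → x ≢ (σ ^ k) h) → x ∈ strip m h xs
    ∈-strip⁺ zero    x∈xs _      = x∈xs
    ∈-strip⁺ (suc m) x∈xs avoids =
      ∈-filter⁺ (λ y → ¬? (y ≟ _)) (∈-strip⁺ m x∈xs (avoids ∘ m≤n⇒m≤1+n)) (avoids ≤-refl)

    strip-unique : ∀ m {h xs} → Unique xs → Unique (strip m h xs)
    strip-unique zero    u = u
    strip-unique (suc m) u = Unique.filter⁺ (λ y → ¬? (y ≟ _)) (strip-unique m u)

    length-strip : ∀ m {h xs} → m ≤ n → Unique xs → Closed xs → h ∈ xs →
                   length xs ≡ m + length (strip m h xs)
    length-strip zero _ _ _ _ = refl
    length-strip (suc m) {h} {xs} m<n u c h∈xs = begin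
      length xs                              ≡⟨ length-strip m (<⇒≤ m<n) u c h∈xs ⟩
      m + length (strip m h xs)              ≡⟨ cong (m +_) (length-delete (strip-unique m u) σᵐh∈) ⟩
      m + suc (length (strip (suc m) h xs))  ≡⟨ +-suc m _ ⟩
      suc m + length (strip (suc m) h xs)    ∎
      where
      open ≡-Reasoning
      σᵐh∈ : (σ ^ m) h ∈ strip m h xs
      σᵐh∈ = ∈-strip⁺ m (Closed⇒σ^k∈ c h∈xs m) (λ k<m → cycle-distinct h k<m m<n ∘ sym)

    strip-closed : ∀ {h xs} → Closed xs → Closed (strip n h xs)
    strip-closed c x∈ with ∈-strip⁻ n x∈
    ... | x∈xs , avoids = ∈-strip⁺ n (c x∈xs) λ k<n σx≡σᵏh →
      let j , j<n , x≡σʲh = σ⁻¹-on-cycle k<n σx≡σᵏh in avoids j<n x≡σʲh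

    n∣length : ∀ {xs} → Unique xs → Closed xs → n ∣ length xs
    n∣length = go (On.wellFounded length <-wellFounded _)
      where
      go : ∀ {xs} → Acc (_<_ on length) xs → Unique xs → Closed xs → n ∣ length xs
      go {[]}         _         _ _ = divides 0 refl
      go {xs@(h ∷ _)} (acc rec) u c =
        subst (n ∣_) (sym len≡) (∣m∣n⇒∣m+n ∣-refl (go (rec shorter) (strip-unique n u) (strip-closed c)))
        where
        len≡ : length xs ≡ n + length (strip n h xs)
        len≡ = length-strip n ≤-refl u c (here refl)
        shorter : length (strip n h xs) < length xs
        shorter = subst (length (strip n h xs) <_) (sym len≡) (m<n+m _ (>-nonZero⁻¹ n))

module _ (G : FiniteGroup) where
  open FiniteGroup G renaming (refl to ≈-refl; sym to ≈-sym; trans to ≈-trans)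
  open import Algebra.Properties.Group group using (identityˡ-unique; ∙-cancelˡ)
  open import Algebra.Properties.Monoid.Mult monoid using (×-congʳ; ×-homo-+; ×-assocˡ) renaming (_×_ to _·_)
  open import Relation.Binary.Reasoning.Setoid setoid

  -- pow agrees with the library's monoid multiple _×_ (renamed _·_ here), whose laws we reuse.
  infixr 8 _^_
  _^_ : Carrier → ℕ → Carrier
  g ^ n = pow G g n

  ^≡· : ∀ g n → g ^ n ≡ n · g
  ^≡· g zero    = refl
  ^≡· g (suc n) = cong (g ∙_) (^≡· g n)

  ^-congˡ : ∀ n {x y} → x ≈ y → x ^ n ≈ y ^ n
  ^-congˡ n {x} {y} x≈y = begin
    x ^ n  ≡⟨ ^≡· x n ⟩
    n · x  ≈⟨ ×-congʳ n x≈y ⟩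
    n · y  ≡⟨ ^≡· y n ⟨
    y ^ n  ∎

  ^-homo-+ : ∀ g m n → g ^ (m + n) ≈ g ^ m ∙ g ^ n
  ^-homo-+ g m n = begin
    g ^ (m + n)    ≡⟨ ^≡· g (m + n) ⟩
    (m + n) · g    ≈⟨ ×-homo-+ g m n ⟩
    m · g ∙ n · g  ≡⟨ cong₂ _∙_ (^≡· g m) (^≡· g n) ⟨
    g ^ m ∙ g ^ n  ∎

  ^-assoc : ∀ g m n → (g ^ m) ^ n ≈ g ^ (n * m)
  ^-assoc g m n = begin
    (g ^ m) ^ n    ≡⟨ ^≡· (g ^ m) n ⟩
    n · (g ^ m)    ≡⟨ cong (n ·_) (^≡· g m) ⟩
    n · (m · g)    ≈⟨ ×-assocˡ g n m ⟩
    (n * m) · g    ≡⟨ ^≡· g (n * m) ⟨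
    g ^ (n * m)    ∎

  ε^n≈ε : ∀ n → ε ^ n ≈ ε
  ε^n≈ε zero    = ≈-refl
  ε^n≈ε (suc n) = ≈-trans (identityˡ _) (ε^n≈ε n)

  ∣⇒^≈ε : ∀ {g n m} → g ^ n ≈ ε → n ∣ m → g ^ m ≈ ε
  ∣⇒^≈ε {g} {n} gⁿ≈ε (divides k refl) = begin
    g ^ (k * n)  ≈⟨ ^-assoc g n k ⟨
    (g ^ n) ^ k  ≈⟨ ^-congˡ k gⁿ≈ε ⟩
    ε ^ k        ≈⟨ ε^n≈ε k ⟩
    ε            ∎

  ^≈^⇒^∸≈ε : ∀ g {i j} → i ≤ j → g ^ i ≈ g ^ j → g ^ (j ∸ i) ≈ ε
  ^≈^⇒^∸≈ε g {i} {j} i≤j gⁱ≈gʲ = identityˡ-unique (g ^ (j ∸ i)) (g ^ i) (begin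
    g ^ (j ∸ i) ∙ g ^ i  ≈⟨ ^-homo-+ g (j ∸ i) i ⟨
    g ^ (j ∸ i + i)      ≡⟨ cong (g ^_) (m∸n+n≡m i≤j) ⟩
    g ^ j                ≈⟨ gⁱ≈gʲ ⟨
    g ^ i                ∎)

  index : Carrier → Fin size
  index x = proj₁ (enum-surj x)

  enum∘index : ∀ x → enum (index x) ≈ x
  enum∘index x = proj₂ (enum-surj x)

  index-injective : ∀ {x y} → index x ≡ index y → x ≈ y
  index-injective {x} {y} eq =
    ≈-trans (≈-sym (enum∘index x)) (≈-trans (reflexive (cong enum eq)) (enum∘index y))

  infix 4 _≈?_
  _≈?_ : ∀ x y → Dec (x ≈ y)
  x ≈? y with index x FinP.≟ index y
  ... | yes eq  = yes (index-injective eq)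
  ... | no  neq = no λ x≈y → neq (enum-inj _ _ (≈-trans (enum∘index x) (≈-trans x≈y (≈-sym (enum∘index y)))))

  ∃^≈ε : ∀ g → ∃ λ d → 0 < d × g ^ d ≈ ε
  ∃^≈ε g with FinP.pigeonhole (n<1+n size) (λ (i : Fin (suc size)) → index (g ^ toℕ i))
  ... | i , j , i<j , eq = toℕ j ∸ toℕ i , m<n⇒0<n∸m i<j , ^≈^⇒^∸≈ε g (<⇒≤ i<j) (index-injective eq)

  order : ∀ g → ∃ (IsOrder G g)
  order g = let d , 0<d , gᵈ≈ε = ∃^≈ε g in leastPositive (λ m → g ^ m ≈? ε) 0<d gᵈ≈ε

  IsOrder⇒∣ : ∀ {g n m} → IsOrder G g n → g ^ m ≈ ε → n ∣ m
  IsOrder⇒∣ {g} {n} {m} (0<n , gⁿ≈ε , minimal) gᵐ≈ε = m%n≡0⇒n∣m m n m%n≡0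
    where
    instance _ = >-nonZero 0<n
    g^[m%n]≈ε : g ^ (m % n) ≈ ε
    g^[m%n]≈ε = begin
      g ^ (m % n)                        ≈⟨ identityʳ _ ⟨
      g ^ (m % n) ∙ ε                    ≈⟨ ∙-congˡ (∣⇒^≈ε gⁿ≈ε (n∣m*n (m / n))) ⟨
      g ^ (m % n) ∙ g ^ (m / n * n)      ≈⟨ ^-homo-+ g (m % n) (m / n * n) ⟨
      g ^ (m % n + m / n * n)            ≡⟨ cong (g ^_) (m≡m%n+[m/n]*n m n) ⟨
      g ^ m                              ≈⟨ gᵐ≈ε ⟩
      ε                                  ∎
    m%n≡0 : m % n ≡ 0
    m%n≡0 with m % n | m%n<n m n | g^[m%n]≈ε
    ... | zero  | _   | _  = refl
    ... | suc r | r<n | gʳ≈ε = contradiction gʳ≈ε (minimal (suc r) z<s r<n)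

  module _ {g n} (ord : IsOrder G g n) where
    open import Function.Endo.Propositional (Fin size) using () renaming (_^_ to _^ᶠ_)

    private
      instance _ = >-nonZero (proj₁ ord)

      translate : Fin size → Fin size
      translate i = index (g ∙ enum i)

      enum∘translate^ : ∀ k i → enum ((translate ^ᶠ k) i) ≈ g ^ k ∙ enum i
      enum∘translate^ zero    i = ≈-sym (identityˡ _)
      enum∘translate^ (suc k) i = begin
        enum (translate ((translate ^ᶠ k) i)) ≈⟨ enum∘index _ ⟩
        g ∙ enum ((translate ^ᶠ k) i)         ≈⟨ ∙-congˡ (enum∘translate^ k i) ⟩
        g ∙ (g ^ k ∙ enum i)                  ≈⟨ assoc _ _ _ ⟨
        g ^ suc k ∙ enum i                    ∎

      translate^n≗id : ∀ i → (translate ^ᶠ n) i ≡ i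
      translate^n≗id i = enum-inj _ _ (≈-trans (enum∘translate^ n i)
        (≈-trans (∙-congʳ (proj₁ (proj₂ ord))) (identityˡ _)))

      translate^k-fixes-nothing : ∀ {k} i → 0 < k → k < n → (translate ^ᶠ k) i ≢ i
      translate^k-fixes-nothing {k} i 0<k k<n fixed = proj₂ (proj₂ ord) k 0<k k<n
        (identityˡ-unique (g ^ k) (enum i) (≈-trans (≈-sym (enum∘translate^ k i)) (reflexive (cong enum fixed))))

      open CycleCounting FinP._≟_ translate n translate^n≗id translate^k-fixes-nothing

    IsOrder⇒∣size : n ∣ size
    IsOrder⇒∣size = subst (n ∣_) (length-tabulate id) (n∣length (Unique.allFin⁺ size) (λ _ → ∈-allFin _))

  ^size≈ε : ∀ g → g ^ size ≈ ε
  ^size≈ε g = let _ , ord = order g in ∣⇒^≈ε (proj₁ (proj₂ ord)) (IsOrder⇒∣size ord)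

  IsOrder-resp-≈ : ∀ {x y n} → x ≈ y → IsOrder G x n → IsOrder G y n
  IsOrder-resp-≈ {n = n} x≈y (0<n , xⁿ≈ε , minimal) =
    0<n , ≈-trans (^-congˡ n (≈-sym x≈y)) xⁿ≈ε ,
    λ m 0<m m<n yᵐ≈ε → minimal m 0<m m<n (≈-trans (^-congˡ m x≈y) yᵐ≈ε)

  HasPrimeOrder-resp-≈ : ∀ {x y} → x ≈ y → HasPrimeOrder G x → HasPrimeOrder G y
  HasPrimeOrder-resp-≈ x≈y (q , ord , q-prime) = q , IsOrder-resp-≈ x≈y ord , q-prime

  ¬HasPrimeOrder[ε] : ∀ {y} → y ≈ ε → ¬ HasPrimeOrder G y
  ¬HasPrimeOrder[ε] y≈ε (q , (_ , _ , minimal) , q-prime) =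
    minimal 1 z<s (nonTrivial⇒n>1 q {{prime⇒nonTrivial q-prime}}) (≈-trans (identityʳ _) y≈ε)

  IsOrder-prime : ∀ {p y} → Prime p → ¬ y ≈ ε → y ^ p ≈ ε → IsOrder G y p
  IsOrder-prime {p} {y} p-prime y≉ε yᵖ≈ε with order y
  ... | n , ord with prime⇒irreducible p-prime (IsOrder⇒∣ ord yᵖ≈ε)
  ...   | inj₁ refl = contradiction (≈-trans (≈-sym (identityʳ y)) (proj₁ (proj₂ ord))) y≉ε
  ...   | inj₂ refl = ord

  ^-injective-below : ∀ {g n i j} → IsOrder G g n → i < j → j < n → ¬ g ^ i ≈ g ^ j
  ^-injective-below {g} {i = i} {j} (_ , _ , minimal) i<j j<n gⁱ≈gʲ =
    minimal _ (m<n⇒0<n∸m i<j) (≤-<-trans (m∸n≤m j i) j<n) (^≈^⇒^∸≈ε g (<⇒≤ i<j) gⁱ≈gʲ)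

  module _ {p x} (p-prime : Prime p) (ord : IsOrder G x (p * p)) where

    HasPrimeOrder-^⇔ : ∀ m → HasPrimeOrder G (x ^ m) ⇔ (p ∣ m × ¬ p * p ∣ m)
    HasPrimeOrder-^⇔ m = mk⇔ necessary sufficient
      where
      instance _ = prime⇒nonZero p-prime

      sufficient : p ∣ m × ¬ p * p ∣ m → HasPrimeOrder G (x ^ m)
      sufficient (p∣m , p*p∤m) = p , IsOrder-prime p-prime (p*p∤m ∘ IsOrder⇒∣ ord) [xᵐ]ᵖ≈ε , p-prime
        where
        [xᵐ]ᵖ≈ε : (x ^ m) ^ p ≈ ε
        [xᵐ]ᵖ≈ε = ≈-trans (^-assoc x m p) (∣⇒^≈ε (proj₁ (proj₂ ord)) (*-monoʳ-∣ p p∣m))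

      necessary : HasPrimeOrder G (x ^ m) → p ∣ m × ¬ p * p ∣ m
      necessary x^m-prime@(q , (_ , [xᵐ]^q≈ε , _) , q-prime) = p∣m , p*p∤m
        where
        p*p∣q*m : p * p ∣ q * m
        p*p∣q*m = IsOrder⇒∣ ord (≈-trans (≈-sym (^-assoc x m q)) [xᵐ]^q≈ε)
        p*p∤m : ¬ p * p ∣ m
        p*p∤m p*p∣m = ¬HasPrimeOrder[ε] (∣⇒^≈ε (proj₁ (proj₂ ord)) p*p∣m) x^m-prime
        p∣m : p ∣ m
        p∣m with euclidsLemma q m p-prime (∣-trans (m∣m*n p) p*p∣q*m)
        ... | inj₂ p∣m = p∣m
        ... | inj₁ p∣q with prime⇒irreducible q-prime p∣q
        ...   | inj₁ refl = contradiction p-prime ¬prime[1]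
        ...   | inj₂ refl = *-cancelˡ-∣ p p*p∣q*m

    ΓAdj-^ : ∀ {i j} → ΓAdj G (x ^ i) (x ^ j) ⇔ (¬ x ^ i ≈ x ^ j × HasPrimeOrder G (x ^ (i + j)))
    ΓAdj-^ {i} {j} = mk⇔
      (λ (≉ , prime) → ≉ , HasPrimeOrder-resp-≈ (≈-sym (^-homo-+ x i j)) prime)
      (λ (≉ , prime) → ≉ , HasPrimeOrder-resp-≈ (^-homo-+ x i j) prime)

  -- With p = r + 1 the exponents are 1, p - 1, p + 1, p² - 1: the three consecutive sums are
  -- p, 2p, p(p + 1) and the other three are p + 2, p², (p - 1)(p + 2).  Only for odd p is 2p not
  -- divisible by p².
  module _ {r x} (p-prime : Prime (suc r)) (2≤r : 2 ≤ r) (ord : IsOrder G x (suc r * suc r)) where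
    private
      p = suc r
      instance
        _ = prime⇒nonZero p-prime
        _ = >-nonZero (<-trans z<s 2≤r)

      1<p : 1 < p
      1<p = s≤s (<⇒≤ 2≤r)
      p∤1 : ¬ p ∣ 1
      p∤1 = >⇒∤ 1<p
      p∤2 : ¬ p ∣ 2
      p∤2 = >⇒∤ (s≤s 2≤r)
      p∤r : ¬ p ∣ r
      p∤r = >⇒∤ ≤-refl
      p∤2+p : ¬ p ∣ 2 + p
      p∤2+p p∣2+p = p∤2 (∣m+n∣m⇒∣n (subst (p ∣_) (+-comm 2 p) p∣2+p) ∣-refl)

      b+c : ∀ r → r + (2 + r) ≡ suc r * 2
      b+c = solve-∀
      c+d : ∀ r → (2 + r) + r * (2 + r) ≡ suc r * (suc r + 1)
      c+d = solve-∀
      a+c : ∀ r → 1 + (2 + r) ≡ 2 + suc r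
      a+c = solve-∀
      a+d : ∀ r → 1 + r * (2 + r) ≡ suc r * suc r
      a+d = solve-∀
      b+d : ∀ r → r + r * (2 + r) ≡ r * (suc r + 2)
      b+d = solve-∀

      PrimeOrderExponent : ℕ → Set
      PrimeOrderExponent s = p ∣ s × ¬ p * p ∣ s

      adjacent : ∀ i j {s} → i + j ≡ s → ¬ x ^ i ≈ x ^ j → PrimeOrderExponent s → ΓAdj G (x ^ i) (x ^ j)
      adjacent i j refl xⁱ≉xʲ s-good = Equivalence.from (ΓAdj-^ p-prime ord {i} {j})
        (xⁱ≉xʲ , Equivalence.from (HasPrimeOrder-^⇔ p-prime ord (i + j)) s-good)

      non-adjacent : ∀ i j {s} → i + j ≡ s → ¬ PrimeOrderExponent s → ¬ ΓAdj G (x ^ i) (x ^ j)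
      non-adjacent i j refl s-bad adj = s-bad (Equivalence.to (HasPrimeOrder-^⇔ p-prime ord (i + j))
        (proj₂ (Equivalence.to (ΓAdj-^ p-prime ord {i} {j}) adj)))

      a b c d : ℕ
      a = 1
      b = r
      c = 2 + r
      d = r * (2 + r)

      a<b : a < b
      a<b = 2≤r
      b<c : b < c
      b<c = m<n+m r z<s
      c<d : c < d
      c<d = subst (c <_) (*-comm c r) (m<m*n c r 2≤r)
      d<p*p : d < p * p
      d<p*p = ≤-reflexive (a+d r)
      c<p*p : c < p * p
      c<p*p = <-trans c<d d<p*p
      b<p*p : b < p * p
      b<p*p = <-trans b<c c<p*p

      distinct : ∀ {i j} → i < j → j < p * p → ¬ x ^ i ≈ x ^ j
      distinct = ^-injective-below ord

      a≉b : ¬ x ^ a ≈ x ^ b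
      a≉b = distinct a<b b<p*p
      a≉c : ¬ x ^ a ≈ x ^ c
      a≉c = distinct (<-trans a<b b<c) c<p*p
      a≉d : ¬ x ^ a ≈ x ^ d
      a≉d = distinct (<-trans a<b (<-trans b<c c<d)) d<p*p
      b≉c : ¬ x ^ b ≈ x ^ c
      b≉c = distinct b<c c<p*p
      b≉d : ¬ x ^ b ≈ x ^ d
      b≉d = distinct (<-trans b<c c<d) d<p*p
      c≉d : ¬ x ^ c ≈ x ^ d
      c≉d = distinct c<d d<p*p

    inducedP4 : InducedP4 G (x ^ a) (x ^ b) (x ^ c) (x ^ d)
    inducedP4 =
      a≉b , a≉c , a≉d , b≉c , b≉d , c≉d ,
      adjacent a b refl a≉b (∣-refl , >⇒∤ (m<m*n p p 1<p)) ,
      adjacent b c (b+c r) b≉c (m∣m*n 2 , p∤2 ∘ *-cancelˡ-∣ p) ,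
      adjacent c d (c+d r) c≉d (m∣m*n (p + 1) , λ p*p∣ → p∤1 (∣m+n∣m⇒∣n (*-cancelˡ-∣ p p*p∣) ∣-refl)) ,
      non-adjacent a c (a+c r) (p∤2+p ∘ proj₁) ,
      non-adjacent a d (a+d r) (λ (_ , p*p∤p*p) → p*p∤p*p ∣-refl) ,
      non-adjacent b d (b+d r) λ (p∣ , _) →
        [ p∤r , p∤2+p ∘ subst (p ∣_) (+-comm p 2) ]′ (euclidsLemma r (p + 2) p-prime p∣)

  order-p*p⇒¬ΓIsCograph : ∀ {p x} → Prime p → p ≢ 2 → IsOrder G x (p * p) → ¬ ΓIsCograph G
  order-p*p⇒¬ΓIsCograph {0} p-prime = contradiction p-prime ¬prime[0]
  order-p*p⇒¬ΓIsCograph {1} p-prime = contradiction p-prime ¬prime[1]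
  order-p*p⇒¬ΓIsCograph {2} _ p≢2   = contradiction refl p≢2
  order-p*p⇒¬ΓIsCograph {suc (suc (suc s))} p-prime _ ord cograph =
    cograph (_ , _ , _ , _ , inducedP4 p-prime (s≤s (s≤s z≤n)) ord)

  IsOrder-p*p : ∀ {p x} → Prime p → ¬ x ^ p ≈ ε → x ^ (p * p) ≈ ε → IsOrder G x (p * p)
  IsOrder-p*p {p} {x} p-prime xᵖ≉ε xᵖᵖ≈ε with order x
  ... | n , ord with ∣p*p⇒∣p⊎≡p*p p-prime (IsOrder⇒∣ ord xᵖᵖ≈ε)
  ...   | inj₁ n∣p  = contradiction (∣⇒^≈ε (proj₁ (proj₂ ord)) n∣p) xᵖ≉ε
  ...   | inj₂ refl = ord

  ∃order-p*p : ∀ {p} → Prime p → ∀ k {g} → ¬ g ^ p ≈ ε → g ^ (p ℕ.^ k) ≈ ε → ∃ λ x → IsOrder G x (p * p)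
  ∃order-p*p {p} p-prime zero {g} gᵖ≉ε g¹≈ε =
    contradiction (≈-trans (^-congˡ p (≈-trans (≈-sym (identityʳ g)) g¹≈ε)) (ε^n≈ε p)) gᵖ≉ε
  ∃order-p*p {p} p-prime (suc k) {g} gᵖ≉ε g^pᵏ⁺¹≈ε with (g ^ p) ^ p ≈? ε
  ... | yes [gᵖ]ᵖ≈ε = g , IsOrder-p*p p-prime gᵖ≉ε (≈-trans (≈-sym (^-assoc g p p)) [gᵖ]ᵖ≈ε)
  ... | no  [gᵖ]ᵖ≉ε = ∃order-p*p p-prime k [gᵖ]ᵖ≉ε (begin
    (g ^ p) ^ (p ℕ.^ k)  ≈⟨ ^-assoc g p (p ℕ.^ k) ⟩
    g ^ (p ℕ.^ k * p)    ≡⟨ cong (g ^_) (*-comm (p ℕ.^ k) p) ⟩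
    g ^ (p ℕ.^ suc k)    ≈⟨ g^pᵏ⁺¹≈ε ⟩
    ε                    ∎)

  ^p≈ε⊎∃order-p*p : ∀ {p k} → Prime p → size ≡ p ℕ.^ k →
                    (∀ g → g ^ p ≈ ε) ⊎ ∃ λ x → IsOrder G x (p * p)
  ^p≈ε⊎∃order-p*p {p} {k} p-prime size≡pᵏ with FinP.all? (λ i → enum i ^ p ≈? ε)
  ... | yes all = inj₁ λ g → ≈-trans (^-congˡ p (≈-sym (enum∘index g))) (all (index g))
  ... | no ¬all = let i , [enum-i]ᵖ≉ε = FinP.¬∀⟶∃¬ size _ (λ i → enum i ^ p ≈? ε) ¬all in
    inj₂ (∃order-p*p p-prime k [enum-i]ᵖ≉ε
      (≈-trans (reflexive (cong (enum i ^_) (sym size≡pᵏ))) (^size≈ε (enum i))))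

  ≉⇒∃≉ε : ∀ {x y} → ¬ x ≈ y → ∃ λ z → ¬ z ≈ ε
  ≉⇒∃≉ε {x} {y} x≉y with x ≈? ε
  ... | no  x≉ε = x , x≉ε
  ... | yes x≈ε = y , λ y≈ε → x≉y (≈-trans x≈ε (≈-sym y≈ε))

  ∃≉ε : 1 < size → ∃ λ y → ¬ y ≈ ε
  ∃≉ε 1<size = ≉⇒∃≉ε (i₀≢i₁ ∘ enum-inj i₀ i₁)
    where
    i₀ i₁ : Fin size
    i₀ = fromℕ< (<-trans z<s 1<size)
    i₁ = fromℕ< 1<size
    i₀≢i₁ : i₀ ≢ i₁
    i₀≢i₁ eq = 0≢1+n (trans (sym (FinP.toℕ-fromℕ< _)) (trans (cong toℕ eq) (FinP.toℕ-fromℕ< 1<size)))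

  ^p≈ε⇒IsExponent : ∀ {p} → Prime p → 1 < size → (∀ g → g ^ p ≈ ε) → IsExponent G p
  ^p≈ε⇒IsExponent p-prime 1<size ^p≈ε = <-trans z<s (nonTrivial⇒n>1 _ {{prime⇒nonTrivial p-prime}}) , ^p≈ε ,
    λ m 0<m m<p ^m≈ε → let y , y≉ε = ∃≉ε 1<size in
      proj₂ (proj₂ (IsOrder-prime p-prime y≉ε (^p≈ε y))) m 0<m m<p (^m≈ε y)

  IsExponent⇒ΓIsCograph : ∀ {p} → Prime p → IsExponent G p → ΓIsCograph G
  IsExponent⇒ΓIsCograph {p} p-prime (_ , ^p≈ε , _)
    (a , _ , c , d , _ , a≉c , a≉d , _ , _ , c≉d , _ , _ , _ , a≁c , a≁d , _) =
    c≉d (∙-cancelˡ a c d (≈-trans (non-adjacent⇒inverse a≉c a≁c) (≈-sym (non-adjacent⇒inverse a≉d a≁d))))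
    where
    non-adjacent⇒inverse : ∀ {x y} → ¬ x ≈ y → ¬ ΓAdj G x y → x ∙ y ≈ ε
    non-adjacent⇒inverse {x} {y} x≉y x≁y with x ∙ y ≈? ε
    ... | yes xy≈ε = xy≈ε
    ... | no  xy≉ε = contradiction (x≉y , p , IsOrder-prime p-prime xy≉ε (^p≈ε (x ∙ y)) , p-prime) x≁y

mainTheorem12 : (p : ℕ) → Prime p → p ≢ 2 → (G : FiniteGroup) →
                IsNontrivialPGroup G p →
                (ΓIsCograph G → IsExponent G p) × (IsExponent G p → ΓIsCograph G)
mainTheorem12 p p-prime p≢2 G (k , 1≤k , size≡pᵏ) = cograph⇒exponent , IsExponent⇒ΓIsCograph G p-prime
  where
  1<size : 1 < FiniteGroup.size G
  1<size = begin-strict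
    1       <⟨ nonTrivial⇒n>1 p {{prime⇒nonTrivial p-prime}} ⟩
    p       ≡⟨ *-identityʳ p ⟨
    p ℕ.^ 1 ≤⟨ ^-monoʳ-≤ p {{prime⇒nonZero p-prime}} 1≤k ⟩
    p ℕ.^ k ≡⟨ size≡pᵏ ⟨
    FiniteGroup.size G ∎
    where open ≤-Reasoning
  cograph⇒exponent : ΓIsCograph G → IsExponent G p
  cograph⇒exponent cograph = [ ^p≈ε⇒IsExponent G p-prime 1<size ,
                               (λ (_ , ord) → contradiction cograph (order-p*p⇒¬ΓIsCograph G p-prime p≢2 ord)) ]′
                             (^p≈ε⊎∃order-p*p G {k = k} p-prime size≡pᵏ)
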